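{- Let $r$ be a nonnegative integer and $n$ an integer with $n\ge r$. Then \[ \begin{aligned} H_n(x)=\;&n!\sum_{k=0}^{r-1}\left\{\sum_{j=0}^{k}\sum_{l=0}^{n}\frac{(r-k)!\,S_2(l+r-k,r-k)\,(-1)^{k-j}\binom{k}{j}2^l H_{n-l}(j)}{(l+r-k)!\,k!\,(n-l)!}\right\}B_k^{(r)}(x)\\ &+n!\sum_{k=r}^{n}\left\{\sum_{j=0}^{r}\frac{(-1)^{r-j}\binom{r}{j}2^{k-r}H_{n-k+r}(j)}{k!\,(n-k+r)!}\right\}B_k^{(r)}(x). \end{aligned} \]
   Context: The Hermite polynomials $H_n(x)$ are defined by $e^{2xt-t^2}=\sum_{n\ge0}H_n(x)\frac{t^n}{n!}$. The Bernoulli polynomials of order $r$ are defined by $\left(\frac{t}{e^t-1}\right)^r e^{xt}=\sum_{n\ge0}B_n^{(r)}(x)\frac{t^n}{n!}$. The Stirling numbers of the second kind $S_2(l,n)$ are defined by $(e^t-1)^n=n!\sum_{l\ge n}S_2(l,n)\frac{t^l}{l!}$. -}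

module Defs where

open import Data.Nat as ℕ using (ℕ; zero; suc; _∸_; _≟_; _!)
open import Data.Nat.Properties using (_!≢0)
open import Data.Nat.Combinatorics using (_C_)
open import Data.Integer using (+_)
open import Data.Rational using (ℚ; 0ℚ; 1ℚ; _+_; _*_; -_; _-_; _/_)
open import Relation.Nullary using (yes; no)

fromℕ : ℕ → ℚ
fromℕ m = (+ m) / 1

sumLt : ℕ → (ℕ → ℚ) → ℚ
sumLt zero f = 0ℚ
sumLt (suc n) f = sumLt n f + f n

-- sumFromTo a b f = Σ_{k=a}^{b} f k  (empty if b < a)
sumFromTo : ℕ → ℕ → (ℕ → ℚ) → ℚ
sumFromTo a b f = sumLt (suc b ∸ a) (λ i → f (a ℕ.+ i))

pow : ℚ → ℕ → ℚ
pow q zero = 1ℚ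
pow q (suc n) = q * pow q n

invFact : ℕ → ℚ
invFact m = (+ 1) / (m !) where instance _ = m !≢0

FPS : Set
FPS = ℕ → ℚ

_⊛_ : FPS → FPS → FPS
(f ⊛ g) n = sumLt (suc n) (λ k → f k * g (n ∸ k))

one : FPS
one zero = 1ℚ
one (suc n) = 0ℚ

powS : FPS → ℕ → FPS
powS f zero = one
powS f (suc r) = f ⊛ powS f r

-- exp(c t) = Σ c^n t^n / n!
expS : ℚ → FPS
expS c n = pow c n * invFact n

-- exp(f) for a series f with zero constant term: Σ_m f^m / m!
-- (the coefficient of t^n only receives contributions from m ≤ n)
expComp : FPS → FPS
expComp f n = sumLt (suc n) (λ m → invFact m * powS f m n)

-- multiplicative inverse of a series g with g 0 = 1:
-- h 0 = 1, h n = - Σ_{k=1}^{n} g k * h (n - k)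
invApprox : FPS → ℕ → FPS
invApprox g zero m = one m
invApprox g (suc n) m with m ≟ suc n
... | yes _ = - sumFromTo 1 (suc n) (λ k → g k * invApprox g n (suc n ∸ k))
... | no _ = invApprox g n m

invS : FPS → FPS
invS g m = invApprox g m m

-- Hermite polynomials: e^{2xt - t^2} = Σ H_n(x) t^n / n!

hermiteExponent : ℚ → FPS
hermiteExponent x zero = 0ℚ
hermiteExponent x (suc zero) = fromℕ 2 * x
hermiteExponent x (suc (suc zero)) = - 1ℚ
hermiteExponent x (suc (suc (suc n))) = 0ℚ

H : ℕ → ℚ → ℚ
H n x = fromℕ (n !) * expComp (hermiteExponent x) n

-- Bernoulli polynomials of order r:
-- (t / (e^t - 1))^r e^{xt} = Σ B_n^{(r)}(x) t^n / n!

expm1 : FPS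
expm1 zero = 0ℚ
expm1 (suc n) = invFact (suc n)

-- (e^t - 1)/t = Σ t^n / (n+1)!
expm1Div : FPS
expm1Div n = invFact (suc n)

bernGen : FPS
bernGen = invS expm1Div

B : ℕ → ℕ → ℚ → ℚ
B r n x = fromℕ (n !) * (powS bernGen r ⊛ expS x) n

-- Stirling numbers of the second kind:
-- (e^t - 1)^n = n! Σ_{l} S2(l,n) t^l / l!

S2 : ℕ → ℕ → ℚ
S2 l n = fromℕ (l !) * invFact n * powS expm1 n l

module Submission where

-- Write E_y(t) = e^{2yt - t²} = Σ H_n(y) tⁿ/n!, G = E_0 = e^{-t²},
-- D_r(t) = ((e^t - 1)/t)^r and b_{r,x}(t) = (t/(e^t - 1))^r e^{xt} = Σ B_k^{(r)}(x) t^k/k!.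
--   (1) E_y = e^{2yt} G, since both sides solve F' = (2y - 2t) F with F(0) = 1.
--   (2) e^{xt} = D_r b_{r,x}; substituting t ↦ 2t in (1) gives
--       E_x = b_{r,x}(2t) Q_r  with  Q_r = D_r(2t) G,
--       so H_n(x)/n! = Σ_{k ≤ n} 2^k B_k^{(r)}(x)/k! · Q_r[n-k].
--   (3) (e^{2t} - 1)^a = (2t)^a D_a(2t), and by the binomial theorem together with
--       e^{2jt} G = E_j we get (e^{2t} - 1)^a G = Σ_j (-1)^{a-j} C(a,j) E_j.
--       For k ≥ r this computes 2^r Q_r[n-k] directly (a = r); for k < r we split
--       D_r = D_{r-k} D_k and use a = k, which brings in the coefficients of
--       D_{r-k}(2t), i.e. the Stirling numbers S₂(l + r - k, r - k).

open import Defs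
open import Data.Nat as ℕ using (ℕ; zero; suc; _∸_; _!; _<_; _≤_; z≤n; s≤s)
  renaming (_+_ to _+ℕ_; _*_ to _*ℕ_; _^_ to _^ℕ_)
import Data.Nat.Properties as ℕP
open import Data.Nat.Combinatorics using (_C_; nCk+nC[k+1]≡[n+1]C[k+1]; k>n⇒nCk≡0)
open import Data.Integer as ℤ using () renaming (+_ to pos)
import Data.Integer.Properties as ℤP
open import Data.Rational using (ℚ; 0ℚ; 1ℚ; _+_; _*_; -_; _/_; toℚᵘ)
open import Data.Rational.Properties
import Data.Rational.Unnormalised as U
import Data.Rational.Unnormalised.Properties as UP
open import Relation.Binary.PropositionalEquality
open import Relation.Nullary using (yes; no)
open import Data.Empty using (⊥-elim)
open import Data.Sum using (_⊎_; inj₁; inj₂)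
open import Data.Maybe using (nothing)
open import Tactic.RingSolver
open import Tactic.RingSolver.Core.AlmostCommutativeRing using (AlmostCommutativeRing; fromCommutativeRing)
open import Level using (0ℓ)
open ≡-Reasoning

ringℚ : AlmostCommutativeRing 0ℓ 0ℓ
ringℚ = fromCommutativeRing +-*-commutativeRing (λ _ → nothing)

-- A fraction i/(1+d) seen as an unnormalised rational; there + and * act by the
-- textbook formulas, which is how fromℕ is shown to be a semiring homomorphism.
toℚᵘ-/ : ∀ i d → toℚᵘ (i / suc d) U.≃ U.mkℚᵘ i d
toℚᵘ-/ i d = toℚᵘ-fromℚᵘ (U.mkℚᵘ i d)

fromℕ-+ : ∀ a b → fromℕ (a +ℕ b) ≡ fromℕ a + fromℕ b
fromℕ-+ a b = toℚᵘ-injective (UP.≃-trans (toℚᵘ-/ (pos (a +ℕ b)) 0) (UP.≃-sym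
  (UP.≃-trans (toℚᵘ-homo-+ (fromℕ a) (fromℕ b))
  (UP.≃-trans (UP.+-cong (toℚᵘ-/ (pos a) 0) (toℚᵘ-/ (pos b) 0))
  (U.*≡* (cong (ℤ._* pos 1) (cong₂ ℤ._+_ (ℤP.*-identityʳ (pos a)) (ℤP.*-identityʳ (pos b)))))))))

fromℕ-* : ∀ a b → fromℕ (a *ℕ b) ≡ fromℕ a * fromℕ b
fromℕ-* a b = toℚᵘ-injective (UP.≃-trans (toℚᵘ-/ (pos (a *ℕ b)) 0) (UP.≃-sym
  (UP.≃-trans (toℚᵘ-homo-* (fromℕ a) (fromℕ b))
  (UP.≃-trans (UP.*-cong (toℚᵘ-/ (pos a) 0) (toℚᵘ-/ (pos b) 0))
  (U.*≡* (trans (ℤP.*-identityʳ _) (trans (sym (ℤP.pos-* a b)) (sym (ℤP.*-identityʳ _)))))))))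

fromℕ-^ : ∀ a n → fromℕ (a ^ℕ n) ≡ pow (fromℕ a) n
fromℕ-^ a zero = refl
fromℕ-^ a (suc n) = trans (fromℕ-* a (a ^ℕ n)) (cong (fromℕ a *_) (fromℕ-^ a n))

fromℕ-*-1/ : ∀ d .{{_ : ℕ.NonZero d}} → fromℕ d * (pos 1 / d) ≡ 1ℚ
fromℕ-*-1/ (suc d) = toℚᵘ-injective (UP.≃-trans (toℚᵘ-homo-* (fromℕ (suc d)) (pos 1 / suc d))
  (UP.≃-trans (UP.*-cong (toℚᵘ-/ (pos (suc d)) 0) (toℚᵘ-/ (pos 1) d)) (U.*≡* eq)))
  where
  eq : pos (suc d) ℤ.* pos 1 ℤ.* pos 1 ≡ pos 1 ℤ.* pos (1 *ℕ suc d)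
  eq = trans (ℤP.*-identityʳ _) (trans (ℤP.*-identityʳ _)
         (trans (cong pos (sym (ℕP.*-identityˡ (suc d)))) (sym (ℤP.*-identityˡ _))))

fact*invFact : ∀ m → fromℕ (m !) * invFact m ≡ 1ℚ
fact*invFact m = fromℕ-*-1/ (m !) {{ℕP._!≢0 m}}

invFact-suc : ∀ n → invFact (suc n) * fromℕ (suc n) ≡ invFact n
invFact-suc n = begin
  invFact (suc n) * fromℕ (suc n)
    ≡⟨ sym (trans (cong (invFact (suc n) * fromℕ (suc n) *_) (fact*invFact n)) (*-identityʳ _)) ⟩
  invFact (suc n) * fromℕ (suc n) * (fromℕ (n !) * invFact n)
    ≡⟨ reassoc (invFact (suc n)) (fromℕ (suc n)) (fromℕ (n !)) (invFact n) ⟩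
  fromℕ (suc n) * fromℕ (n !) * invFact (suc n) * invFact n
    ≡⟨ cong (λ z → z * invFact (suc n) * invFact n) (sym (fromℕ-* (suc n) (n !))) ⟩
  fromℕ (suc n !) * invFact (suc n) * invFact n
    ≡⟨ cong (_* invFact n) (fact*invFact (suc n)) ⟩
  1ℚ * invFact n
    ≡⟨ *-identityˡ (invFact n) ⟩
  invFact n ∎
  where
  reassoc : ∀ a b c d → a * b * (c * d) ≡ b * c * a * d
  reassoc = solve-∀ ringℚ

cancel-fromℕ : ∀ d .{{_ : ℕ.NonZero d}} a b → fromℕ d * a ≡ fromℕ d * b → a ≡ b
cancel-fromℕ d a b eq = begin
  a                  ≡⟨ sym (*-identityˡ a) ⟩
  1ℚ * a             ≡⟨ cong (_* a) (sym (fromℕ-*-1/ d)) ⟩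
  (fromℕ d * w) * a  ≡⟨ reassoc (fromℕ d) w a ⟩
  w * (fromℕ d * a)  ≡⟨ cong (w *_) eq ⟩
  w * (fromℕ d * b)  ≡⟨ sym (reassoc (fromℕ d) w b) ⟩
  (fromℕ d * w) * b  ≡⟨ cong (_* b) (fromℕ-*-1/ d) ⟩
  1ℚ * b             ≡⟨ *-identityˡ b ⟩
  b ∎
  where
  w : ℚ
  w = pos 1 / d
  reassoc : ∀ x y z → (x * y) * z ≡ y * (x * z)
  reassoc = solve-∀ ringℚ

pow-+ : ∀ q a b → pow q (a +ℕ b) ≡ pow q a * pow q b
pow-+ q zero b = sym (*-identityˡ _)
pow-+ q (suc a) b = trans (cong (q *_) (pow-+ q a b)) (sym (*-assoc q _ _))

pow-* : ∀ p q n → pow (p * q) n ≡ pow p n * pow q n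
pow-* p q zero = refl
pow-* p q (suc n) = trans (cong ((p * q) *_) (pow-* p q n)) (interchange p q (pow p n) (pow q n))
  where
  interchange : ∀ a b c d → (a * b) * (c * d) ≡ (a * c) * (b * d)
  interchange = solve-∀ ringℚ

neg-one-* : ∀ a → - 1ℚ * a ≡ - a
neg-one-* a = trans (sym (neg-distribˡ-* 1ℚ a)) (cong -_ (*-identityˡ a))

sum-cong< : ∀ n {f g : ℕ → ℚ} → (∀ i → i < n → f i ≡ g i) → sumLt n f ≡ sumLt n g
sum-cong< zero h = refl
sum-cong< (suc n) h = cong₂ _+_ (sum-cong< n (λ i i<n → h i (ℕP.m<n⇒m<1+n i<n))) (h n (ℕP.n<1+n n))

sum-cong : ∀ n {f g : ℕ → ℚ} → (∀ i → f i ≡ g i) → sumLt n f ≡ sumLt n g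
sum-cong n h = sum-cong< n (λ i _ → h i)

sum-0 : ∀ n → sumLt n (λ _ → 0ℚ) ≡ 0ℚ
sum-0 zero = refl
sum-0 (suc n) = cong (_+ 0ℚ) (sum-0 n)

sum-+ : ∀ n (f g : ℕ → ℚ) → sumLt n (λ i → f i + g i) ≡ sumLt n f + sumLt n g
sum-+ zero f g = refl
sum-+ (suc n) f g = trans (cong (_+ (f n + g n)) (sum-+ n f g)) (interchange (sumLt n f) (sumLt n g) (f n) (g n))
  where
  interchange : ∀ a b c d → (a + b) + (c + d) ≡ (a + c) + (b + d)
  interchange = solve-∀ ringℚ

sum-scaleˡ : ∀ n c (f : ℕ → ℚ) → c * sumLt n f ≡ sumLt n (λ i → c * f i)
sum-scaleˡ zero c f = *-zeroʳ c
sum-scaleˡ (suc n) c f = trans (*-distribˡ-+ c _ _) (cong (_+ c * f n) (sum-scaleˡ n c f))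

sum-scaleʳ : ∀ n c (f : ℕ → ℚ) → sumLt n f * c ≡ sumLt n (λ i → f i * c)
sum-scaleʳ n c f = trans (*-comm _ c) (trans (sum-scaleˡ n c f) (sum-cong n (λ i → *-comm c (f i))))

sum-neg : ∀ n (f : ℕ → ℚ) → - sumLt n f ≡ sumLt n (λ i → - f i)
sum-neg zero f = refl
sum-neg (suc n) f = trans (neg-distrib-+ (sumLt n f) (f n)) (cong (_+ - f n) (sum-neg n f))

sum-front : ∀ n (f : ℕ → ℚ) → sumLt (suc n) f ≡ f 0 + sumLt n (λ i → f (suc i))
sum-front zero f = trans (+-identityˡ (f 0)) (sym (+-identityʳ (f 0)))
sum-front (suc n) f = trans (cong (_+ f (suc n)) (sum-front n f)) (+-assoc (f 0) (sumLt n (λ i → f (suc i))) (f (suc n)))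

sum-split : ∀ a b (f : ℕ → ℚ) → sumLt (a +ℕ b) f ≡ sumLt a f + sumLt b (λ i → f (a +ℕ i))
sum-split a zero f = trans (cong (λ m → sumLt m f) (ℕP.+-identityʳ a)) (sym (+-identityʳ _))
sum-split a (suc b) f = begin
  sumLt (a +ℕ suc b) f                                    ≡⟨ cong (λ m → sumLt m f) (ℕP.+-suc a b) ⟩
  sumLt (a +ℕ b) f + f (a +ℕ b)                           ≡⟨ cong (_+ f (a +ℕ b)) (sum-split a b f) ⟩
  (sumLt a f + sumLt b (λ i → f (a +ℕ i))) + f (a +ℕ b)   ≡⟨ +-assoc (sumLt a f) _ (f (a +ℕ b)) ⟩
  sumLt a f + (sumLt b (λ i → f (a +ℕ i)) + f (a +ℕ b))   ∎

sum-swap : ∀ n m (f : ℕ → ℕ → ℚ) →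
  sumLt n (λ i → sumLt m (λ j → f i j)) ≡ sumLt m (λ j → sumLt n (λ i → f i j))
sum-swap zero m f = sym (sum-0 m)
sum-swap (suc n) m f = trans (cong (_+ sumLt m (λ j → f n j)) (sum-swap n m f)) (sym (sum-+ m _ _))

sum-swap-factor : ∀ a b c (Y : ℕ → ℚ) (X : ℕ → ℕ → ℚ) →
  sumLt a (λ j → sumLt b (λ l → c * (Y l * X j l))) ≡ c * sumLt b (λ l → Y l * sumLt a (λ j → X j l))
sum-swap-factor a b c Y X = begin
  sumLt a (λ j → sumLt b (λ l → c * (Y l * X j l)))
    ≡⟨ sum-swap a b (λ j l → c * (Y l * X j l)) ⟩
  sumLt b (λ l → sumLt a (λ j → c * (Y l * X j l)))
    ≡⟨ sum-cong b (λ l → trans (sym (sum-scaleˡ a c (λ j → Y l * X j l)))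
                                (cong (c *_) (sym (sum-scaleˡ a (Y l) (λ j → X j l))))) ⟩
  sumLt b (λ l → c * (Y l * sumLt a (λ j → X j l)))
    ≡⟨ sym (sum-scaleˡ b c (λ l → Y l * sumLt a (λ j → X j l))) ⟩
  c * sumLt b (λ l → Y l * sumLt a (λ j → X j l)) ∎

sum-rev : ∀ n (f : ℕ → ℚ) → sumLt (suc n) f ≡ sumLt (suc n) (λ k → f (n ∸ k))
sum-rev zero f = refl
sum-rev (suc n) f = begin
  sumLt (suc n) f + f (suc n)                   ≡⟨ cong (_+ f (suc n)) (sum-rev n f) ⟩
  sumLt (suc n) (λ k → f (n ∸ k)) + f (suc n)   ≡⟨ +-comm (sumLt (suc n) (λ k → f (n ∸ k))) (f (suc n)) ⟩
  f (suc n) + sumLt (suc n) (λ k → f (n ∸ k))   ≡⟨ sym (sum-front (suc n) (λ k → f (suc n ∸ k))) ⟩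
  sumLt (suc (suc n)) (λ k → f (suc n ∸ k))     ∎

sum-tri : ∀ n (F : ℕ → ℕ → ℚ) →
  sumLt (suc n) (λ a → sumLt (suc a) (λ b → F a b)) ≡
  sumLt (suc n) (λ b → sumLt (suc (n ∸ b)) (λ c → F (b +ℕ c) b))
sum-tri zero F = refl
sum-tri (suc n) F = begin
  sumLt (suc n) (λ a → sumLt (suc a) (F a)) + (sumLt (suc n) (F (suc n)) + F (suc n) (suc n))
    ≡⟨ cong (_+ (sumLt (suc n) (F (suc n)) + F (suc n) (suc n))) (sum-tri n F) ⟩
  R n + (sumLt (suc n) (F (suc n)) + F (suc n) (suc n))
    ≡⟨ sym (+-assoc (R n) (sumLt (suc n) (F (suc n))) (F (suc n) (suc n))) ⟩
  (R n + sumLt (suc n) (F (suc n))) + F (suc n) (suc n)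
    ≡⟨ cong (_+ F (suc n) (suc n)) (sym (sum-+ (suc n) _ _)) ⟩
  sumLt (suc n) (λ b → sumLt (suc (n ∸ b)) (λ c → F (b +ℕ c) b) + F (suc n) b) + F (suc n) (suc n)
    ≡⟨ cong₂ _+_ (sum-cong< (suc n) extend) last ⟩
  R (suc n) ∎
  where
  R : ℕ → ℚ
  R m = sumLt (suc m) (λ b → sumLt (suc (m ∸ b)) (λ c → F (b +ℕ c) b))
  last : F (suc n) (suc n) ≡ sumLt (suc (n ∸ n)) (λ c → F (suc n +ℕ c) (suc n))
  last rewrite ℕP.n∸n≡0 n | ℕP.+-identityʳ n = sym (+-identityˡ _)
  extend : ∀ b → b < suc n →
    sumLt (suc (n ∸ b)) (λ c → F (b +ℕ c) b) + F (suc n) b ≡ sumLt (suc (suc n ∸ b)) (λ c → F (b +ℕ c) b)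
  extend b (s≤s b≤n) rewrite ℕP.+-∸-assoc 1 b≤n =
    cong (λ m → sumLt (suc (n ∸ b)) (λ c → F (b +ℕ c) b) + F m b)
         (sym (trans (ℕP.+-suc b (n ∸ b)) (cong suc (ℕP.m+[n∸m]≡n b≤n))))

sum-split-at : ∀ r N (f : ℕ → ℚ) → r ≤ N → sumLt N f ≡ sumLt r f + sumLt (N ∸ r) (λ i → f (r +ℕ i))
sum-split-at r N f r≤N = trans (cong (λ m → sumLt m f) (sym (ℕP.m+[n∸m]≡n r≤N))) (sum-split r (N ∸ r) f)

infix 4 _≈_
record _≈_ (f g : FPS) : Set where
  constructor ≈i
  field at : ∀ n → f n ≡ g n
open _≈_ public

≈-refl : ∀ {f} → f ≈ f
≈-refl = ≈i λ n → refl

≈-sym : ∀ {f g} → f ≈ g → g ≈ f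
≈-sym p = ≈i λ n → sym (at p n)

≈-trans : ∀ {f g h} → f ≈ g → g ≈ h → f ≈ h
≈-trans p q = ≈i λ n → trans (at p n) (at q n)

_⊕_ : FPS → FPS → FPS
(f ⊕ g) n = f n + g n

scale : ℚ → FPS → FPS
scale c f n = c * f n

-- f(ct)
dilate : ℚ → FPS → FPS
dilate c f n = pow c n * f n

shift : FPS → FPS
shift f zero = 0ℚ
shift f (suc n) = f n

shiftBy : ℕ → FPS → FPS
shiftBy zero f = f
shiftBy (suc k) f = shift (shiftBy k f)

shiftBy-at : ∀ k f m → shiftBy k f (k +ℕ m) ≡ f m
shiftBy-at zero f m = refl
shiftBy-at (suc k) f m = shiftBy-at k f m

⊛-cong : ∀ {f f′ g g′} → f ≈ f′ → g ≈ g′ → f ⊛ g ≈ f′ ⊛ g′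
⊛-cong p q = ≈i λ n → sum-cong (suc n) (λ k → cong₂ _*_ (at p k) (at q (n ∸ k)))

⊛-congʳ : ∀ f {g g′} → g ≈ g′ → f ⊛ g ≈ f ⊛ g′
⊛-congʳ f = ⊛-cong (≈-refl {f})

⊛-congˡ : ∀ g {f f′} → f ≈ f′ → f ⊛ g ≈ f′ ⊛ g
⊛-congˡ g p = ⊛-cong p (≈-refl {g})

⊕-cong : ∀ {f f′ g g′} → f ≈ f′ → g ≈ g′ → f ⊕ g ≈ f′ ⊕ g′
⊕-cong p q = ≈i λ n → cong₂ _+_ (at p n) (at q n)

scale-cong : ∀ c {f g} → f ≈ g → scale c f ≈ scale c g
scale-cong c p = ≈i λ n → cong (c *_) (at p n)

dilate-cong : ∀ c {f g} → f ≈ g → dilate c f ≈ dilate c g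
dilate-cong c p = ≈i λ n → cong (pow c n *_) (at p n)

shift-cong : ∀ {f g} → f ≈ g → shift f ≈ shift g
shift-cong p = ≈i λ { zero → refl ; (suc n) → at p n }

shiftBy-cong : ∀ k {f g} → f ≈ g → shiftBy k f ≈ shiftBy k g
shiftBy-cong zero p = p
shiftBy-cong (suc k) p = shift-cong (shiftBy-cong k p)

⊛-comm : ∀ f g → f ⊛ g ≈ g ⊛ f
⊛-comm f g = ≈i λ n → trans (sum-rev n (λ k → f k * g (n ∸ k))) (sum-cong< (suc n) (swap n))
  where
  swap : ∀ n k → k < suc n → f (n ∸ k) * g (n ∸ (n ∸ k)) ≡ g k * f (n ∸ k)
  swap n k (s≤s k≤n) = trans (*-comm (f (n ∸ k)) _) (cong (λ m → g m * f (n ∸ k)) (ℕP.m∸[m∸n]≡n k≤n))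

⊛-assoc : ∀ f g h → (f ⊛ g) ⊛ h ≈ f ⊛ (g ⊛ h)
⊛-assoc f g h = ≈i λ n → begin
  sumLt (suc n) (λ a → sumLt (suc a) (λ b → f b * g (a ∸ b)) * h (n ∸ a))
    ≡⟨ sum-cong (suc n) (λ a → sum-scaleʳ (suc a) (h (n ∸ a)) (λ b → f b * g (a ∸ b))) ⟩
  sumLt (suc n) (λ a → sumLt (suc a) (λ b → f b * g (a ∸ b) * h (n ∸ a)))
    ≡⟨ sum-tri n (λ a b → f b * g (a ∸ b) * h (n ∸ a)) ⟩
  sumLt (suc n) (λ b → sumLt (suc (n ∸ b)) (λ c → f b * g ((b +ℕ c) ∸ b) * h (n ∸ (b +ℕ c))))
    ≡⟨ sum-cong (suc n) (λ b → sum-cong (suc (n ∸ b)) (λ c → trans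
         (cong₂ (λ u v → f b * g u * h v) (ℕP.m+n∸m≡n b c) (sym (ℕP.∸-+-assoc n b c)))
         (*-assoc (f b) (g c) (h (n ∸ b ∸ c))))) ⟩
  sumLt (suc n) (λ b → sumLt (suc (n ∸ b)) (λ c → f b * (g c * h (n ∸ b ∸ c))))
    ≡⟨ sym (sum-cong (suc n) (λ b → sum-scaleˡ (suc (n ∸ b)) (f b) (λ c → g c * h (n ∸ b ∸ c)))) ⟩
  sumLt (suc n) (λ b → f b * sumLt (suc (n ∸ b)) (λ c → g c * h (n ∸ b ∸ c))) ∎

one-⊛ : ∀ f → one ⊛ f ≈ f
one-⊛ f = ≈i λ n → begin
  sumLt (suc n) (λ k → one k * f (n ∸ k))
    ≡⟨ sum-front n (λ k → one k * f (n ∸ k)) ⟩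
  1ℚ * f n + sumLt n (λ i → 0ℚ * f (n ∸ suc i))
    ≡⟨ cong₂ _+_ (*-identityˡ (f n)) (trans (sum-cong n (λ i → *-zeroˡ (f (n ∸ suc i)))) (sum-0 n)) ⟩
  f n + 0ℚ
    ≡⟨ +-identityʳ (f n) ⟩
  f n ∎

⊛-one : ∀ f → f ⊛ one ≈ f
⊛-one f = ≈-trans (⊛-comm f one) (one-⊛ f)

⊛-interchange : ∀ a b c d → (a ⊛ b) ⊛ (c ⊛ d) ≈ (a ⊛ c) ⊛ (b ⊛ d)
⊛-interchange a b c d =
  ≈-trans (⊛-assoc a b (c ⊛ d))
  (≈-trans (⊛-congʳ a (≈-sym (⊛-assoc b c d)))
  (≈-trans (⊛-congʳ a (⊛-congˡ d (⊛-comm b c)))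
  (≈-trans (⊛-congʳ a (⊛-assoc c b d))
  (≈-sym (⊛-assoc a c (b ⊛ d))))))

⊕-⊛ : ∀ f g h → (g ⊕ h) ⊛ f ≈ (g ⊛ f) ⊕ (h ⊛ f)
⊕-⊛ f g h = ≈i λ n → trans (sum-cong (suc n) (λ k → *-distribʳ-+ (f (n ∸ k)) (g k) (h k)))
  (sum-+ (suc n) (λ k → g k * f (n ∸ k)) (λ k → h k * f (n ∸ k)))

sum-⊛ : ∀ m f (A : ℕ → FPS) → (λ N → sumLt m (λ j → A j N)) ⊛ f ≈ (λ N → sumLt m (λ j → (A j ⊛ f) N))
sum-⊛ m f A = ≈i λ n → begin
  sumLt (suc n) (λ k → sumLt m (λ j → A j k) * f (n ∸ k))
    ≡⟨ sum-cong (suc n) (λ k → sum-scaleʳ m (f (n ∸ k)) (λ j → A j k)) ⟩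
  sumLt (suc n) (λ k → sumLt m (λ j → A j k * f (n ∸ k)))
    ≡⟨ sum-swap (suc n) m (λ k j → A j k * f (n ∸ k)) ⟩
  sumLt m (λ j → sumLt (suc n) (λ k → A j k * f (n ∸ k))) ∎

scale-⊛ : ∀ c f g → scale c f ⊛ g ≈ scale c (f ⊛ g)
scale-⊛ c f g = ≈i λ n → trans (sum-cong (suc n) (λ k → *-assoc c (f k) (g (n ∸ k))))
  (sym (sum-scaleˡ (suc n) c (λ k → f k * g (n ∸ k))))

⊛-scale : ∀ c f g → f ⊛ scale c g ≈ scale c (f ⊛ g)
⊛-scale c f g = ≈-trans (⊛-comm f (scale c g)) (≈-trans (scale-⊛ c g f) (scale-cong c (⊛-comm g f)))

scale-as-⊛ : ∀ c F → scale c F ≈ scale c one ⊛ F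
scale-as-⊛ c F = ≈-sym (≈-trans (scale-⊛ c one F) (scale-cong c (one-⊛ F)))

scale-⊕ : ∀ a b F → scale a F ⊕ scale b F ≈ scale (a + b) F
scale-⊕ a b F = ≈i λ n → sym (*-distribʳ-+ (F n) a b)

shift-⊛ : ∀ f g → shift f ⊛ g ≈ shift (f ⊛ g)
shift-⊛ f g = ≈i λ
  { zero → trans (+-identityˡ _) (*-zeroˡ (g 0))
  ; (suc n) → trans (sum-front (suc n) (λ k → shift f k * g (suc n ∸ k)))
                    (trans (cong (_+ (f ⊛ g) n) (*-zeroˡ (g (suc n)))) (+-identityˡ _)) }

shiftBy-⊛ : ∀ k f g → shiftBy k f ⊛ g ≈ shiftBy k (f ⊛ g)
shiftBy-⊛ zero f g = ≈-refl
shiftBy-⊛ (suc k) f g = ≈-trans (shift-⊛ (shiftBy k f) g) (shift-cong (shiftBy-⊛ k f g))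

⊛-shiftBy : ∀ k f g → f ⊛ shiftBy k g ≈ shiftBy k (f ⊛ g)
⊛-shiftBy k f g = ≈-trans (⊛-comm f (shiftBy k g)) (≈-trans (shiftBy-⊛ k g f) (shiftBy-cong k (⊛-comm g f)))

dilate-⊛ : ∀ c f g → dilate c (f ⊛ g) ≈ dilate c f ⊛ dilate c g
dilate-⊛ c f g = ≈i λ n → trans (sum-scaleˡ (suc n) (pow c n) (λ k → f k * g (n ∸ k))) (sum-cong< (suc n) (split n))
  where
  interchange : ∀ a b x y → (a * b) * (x * y) ≡ (a * x) * (b * y)
  interchange = solve-∀ ringℚ
  split : ∀ n k → k < suc n → pow c n * (f k * g (n ∸ k)) ≡ (pow c k * f k) * (pow c (n ∸ k) * g (n ∸ k))
  split n k (s≤s k≤n) = trans (cong (λ m → pow c m * (f k * g (n ∸ k))) (sym (ℕP.m+[n∸m]≡n k≤n)))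
     (trans (cong (_* (f k * g (n ∸ k))) (pow-+ c k (n ∸ k))) (interchange (pow c k) (pow c (n ∸ k)) (f k) (g (n ∸ k))))

dilate-one : ∀ c → dilate c one ≈ one
dilate-one c = ≈i λ { zero → *-identityˡ 1ℚ ; (suc n) → *-zeroʳ (pow c (suc n)) }

dilate-shiftBy : ∀ k c f → dilate c (shiftBy k f) ≈ scale (pow c k) (shiftBy k (dilate c f))
dilate-shiftBy zero c f = ≈i λ n → sym (*-identityˡ _)
dilate-shiftBy (suc k) c f = ≈i λ
  { zero → trans (*-zeroʳ 1ℚ) (sym (*-zeroʳ (c * pow c k)))
  ; (suc n) → trans (*-assoc c (pow c n) _)
                    (trans (cong (c *_) (at (dilate-shiftBy k c f) n)) (sym (*-assoc c (pow c k) _))) }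

powS-cong : ∀ r {f g} → f ≈ g → powS f r ≈ powS g r
powS-cong zero p = ≈-refl
powS-cong (suc r) p = ⊛-cong p (powS-cong r p)

powS-idx : ∀ f {a b} → a ≡ b → powS f a ≈ powS f b
powS-idx f refl = ≈-refl

powS-+ : ∀ f a b → powS f (a +ℕ b) ≈ powS f a ⊛ powS f b
powS-+ f zero b = ≈-sym (one-⊛ (powS f b))
powS-+ f (suc a) b = ≈-trans (⊛-congʳ f (powS-+ f a b)) (≈-sym (⊛-assoc f (powS f a) (powS f b)))

powS-⊛ : ∀ r f g → powS (f ⊛ g) r ≈ powS f r ⊛ powS g r
powS-⊛ zero f g = ≈-sym (one-⊛ one)
powS-⊛ (suc r) f g = ≈-trans (⊛-congʳ (f ⊛ g) (powS-⊛ r f g)) (⊛-interchange f g (powS f r) (powS g r))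

powS-one : ∀ r → powS one r ≈ one
powS-one zero = ≈-refl
powS-one (suc r) = ≈-trans (one-⊛ (powS one r)) (powS-one r)

powS-dilate : ∀ r c f → powS (dilate c f) r ≈ dilate c (powS f r)
powS-dilate zero c f = ≈-sym (dilate-one c)
powS-dilate (suc r) c f = ≈-trans (⊛-congʳ (dilate c f) (powS-dilate r c f)) (≈-sym (dilate-⊛ c f (powS f r)))

powS-shift : ∀ r f → powS (shift f) r ≈ shiftBy r (powS f r)
powS-shift zero f = ≈-refl
powS-shift (suc r) f = ≈-trans (⊛-congʳ (shift f) (powS-shift r f))
  (≈-trans (shift-⊛ f (shiftBy r (powS f r))) (shift-cong (⊛-shiftBy r f (powS f r))))

powS-vanish : ∀ f → f 0 ≡ 0ℚ → ∀ m n → n < m → powS f m n ≡ 0ℚ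
powS-vanish f f0 (suc m) n (s≤s n≤m) = begin
  sumLt (suc n) (λ k → f k * powS f m (n ∸ k))
    ≡⟨ sum-front n (λ k → f k * powS f m (n ∸ k)) ⟩
  f 0 * powS f m n + sumLt n (λ i → f (suc i) * powS f m (n ∸ suc i))
    ≡⟨ cong₂ _+_ (trans (cong (_* powS f m n) f0) (*-zeroˡ (powS f m n))) (trans (sum-cong< n (vanish n≤m)) (sum-0 n)) ⟩
  0ℚ + 0ℚ
    ≡⟨ +-identityˡ 0ℚ ⟩
  0ℚ ∎
  where
  vanish : ∀ {n} → n ≤ m → ∀ i → i < n → f (suc i) * powS f m (n ∸ suc i) ≡ 0ℚ
  vanish {suc n′} n≤m i (s≤s i≤n′) = trans
    (cong (f (suc i) *_) (powS-vanish f f0 m (n′ ∸ i) (ℕP.≤-trans (s≤s (ℕP.m∸n≤m n′ i)) n≤m)))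
    (*-zeroʳ (f (suc i)))

invS-suc : ∀ g n → invS g (suc n) ≡ - sumFromTo 1 (suc n) (λ k → g k * invApprox g n (suc n ∸ k))
invS-suc g n with suc n ℕ.≟ suc n
... | yes _ = refl
... | no ¬p = ⊥-elim (¬p refl)

invApprox-stable : ∀ g n m → m ≤ n → invApprox g n m ≡ invS g m
invApprox-stable g zero zero z≤n = refl
invApprox-stable g (suc n) m m≤ with m ℕ.≟ suc n
... | yes refl = sym (invS-suc g n)
... | no m≢ = invApprox-stable g n m (ℕP.≤-pred (ℕP.≤∧≢⇒< m≤ m≢))

invS-right : ∀ g → g 0 ≡ 1ℚ → g ⊛ invS g ≈ one
invS-right g g0 = ≈i λ
  { zero → trans (+-identityˡ _) (trans (cong (_* invS g 0) g0) (*-identityˡ 1ℚ))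
  ; (suc n) → begin
      sumLt (suc (suc n)) (λ k → g k * invS g (suc n ∸ k))
        ≡⟨ sum-front (suc n) (λ k → g k * invS g (suc n ∸ k)) ⟩
      g 0 * invS g (suc n) + sumLt (suc n) (λ i → g (suc i) * invS g (n ∸ i))
        ≡⟨ cong₂ _+_ (trans (cong (_* invS g (suc n)) g0) (trans (*-identityˡ _) (invS-suc g n)))
                      (sum-cong (suc n) (λ i → cong (g (suc i) *_) (sym (invApprox-stable g n (n ∸ i) (ℕP.m∸n≤m n i))))) ⟩
      - tail n + tail n
        ≡⟨ +-inverseˡ (tail n) ⟩
      0ℚ ∎ }
  where
  tail : ℕ → ℚ
  tail n = sumLt (suc n) (λ i → g (suc i) * invApprox g n (n ∸ i))

expm1Div-bernGen : ∀ r → powS expm1Div r ⊛ powS bernGen r ≈ one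
expm1Div-bernGen r = ≈-trans (≈-sym (powS-⊛ r expm1Div bernGen))
  (≈-trans (powS-cong r (invS-right expm1Div refl)) (powS-one r))

deriv : FPS → FPS
deriv f n = fromℕ (suc n) * f (suc n)

deriv-cong : ∀ {f g} → f ≈ g → deriv f ≈ deriv g
deriv-cong p = ≈i λ n → cong (fromℕ (suc n) *_) (at p (suc n))

deriv-one : deriv one ≈ (λ _ → 0ℚ)
deriv-one = ≈i λ n → *-zeroʳ (fromℕ (suc n))

-- Leibniz rule, proved by writing (n+1) = k + (n+1-k) inside the product sum.
deriv-⊛ : ∀ f g → deriv (f ⊛ g) ≈ (deriv f ⊛ g) ⊕ (f ⊛ deriv g)
deriv-⊛ f g = ≈i λ n → begin
  fromℕ (suc n) * sumLt (suc (suc n)) (λ k → f k * g (suc n ∸ k))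
    ≡⟨ sum-scaleˡ (suc (suc n)) (fromℕ (suc n)) (λ k → f k * g (suc n ∸ k)) ⟩
  sumLt (suc (suc n)) (λ k → fromℕ (suc n) * (f k * g (suc n ∸ k)))
    ≡⟨ sum-cong< (suc (suc n)) (split n) ⟩
  sumLt (suc (suc n)) (λ k → left n k + right n k)
    ≡⟨ sum-+ (suc (suc n)) (left n) (right n) ⟩
  sumLt (suc (suc n)) (left n) + sumLt (suc (suc n)) (right n)
    ≡⟨ cong₂ _+_ (left-sum n) (right-sum n) ⟩
  (deriv f ⊛ g) n + (f ⊛ deriv g) n ∎
  where
  left right : ℕ → ℕ → ℚ
  left n k = fromℕ k * f k * g (suc n ∸ k)
  right n k = fromℕ (suc n ∸ k) * (f k * g (suc n ∸ k))
  distrib : ∀ a b x y → (a + b) * (x * y) ≡ a * x * y + b * (x * y)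
  distrib = solve-∀ ringℚ
  split : ∀ n k → k < suc (suc n) → fromℕ (suc n) * (f k * g (suc n ∸ k)) ≡ left n k + right n k
  split n k (s≤s k≤) = trans (cong (λ m → fromℕ m * (f k * g (suc n ∸ k))) (sym (ℕP.m+[n∸m]≡n k≤)))
     (trans (cong (_* (f k * g (suc n ∸ k))) (fromℕ-+ k (suc n ∸ k)))
            (distrib (fromℕ k) (fromℕ (suc n ∸ k)) (f k) (g (suc n ∸ k))))
  left-sum : ∀ n → sumLt (suc (suc n)) (left n) ≡ (deriv f ⊛ g) n
  left-sum n = trans (sum-front (suc n) (left n))
     (trans (cong (_+ sumLt (suc n) (λ i → left n (suc i))) (trans (cong (_* g (suc n)) (*-zeroˡ (f 0))) (*-zeroˡ (g (suc n)))))
            (+-identityˡ _))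
  swap : ∀ a x y → a * (x * y) ≡ x * (a * y)
  swap = solve-∀ ringℚ
  right-term : ∀ n k → k < suc n → right n k ≡ f k * deriv g (n ∸ k)
  right-term n k (s≤s k≤n) rewrite ℕP.+-∸-assoc 1 k≤n = swap (fromℕ (suc (n ∸ k))) (f k) (g (suc (n ∸ k)))
  right-sum : ∀ n → sumLt (suc (suc n)) (right n) ≡ (f ⊛ deriv g) n
  right-sum n = trans (cong (_+ right n (suc n)) (sum-cong< (suc n) (right-term n)))
     (trans (cong ((f ⊛ deriv g) n +_)
                  (trans (cong (λ m → fromℕ m * (f (suc n) * g m)) (ℕP.n∸n≡0 (suc n))) (*-zeroˡ (f (suc n) * g 0))))
            (+-identityʳ _))

ode-unique : ∀ p F F′ → deriv F ≈ p ⊛ F → deriv F′ ≈ p ⊛ F′ → F 0 ≡ F′ 0 → F ≈ F′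
ode-unique p F F′ dF dF′ F0 = ≈i λ n → upTo n n ℕP.≤-refl
  where
  upTo : ∀ n m → m ≤ n → F m ≡ F′ m
  upTo zero zero z≤n = F0
  upTo (suc n) m m≤ with m ℕ.≟ suc n
  ... | no m≢ = upTo n m (ℕP.≤-pred (ℕP.≤∧≢⇒< m≤ m≢))
  ... | yes refl = cancel-fromℕ (suc n) (F (suc n)) (F′ (suc n)) (begin
        fromℕ (suc n) * F (suc n)               ≡⟨ at dF n ⟩
        sumLt (suc n) (λ k → p k * F (n ∸ k))   ≡⟨ sum-cong (suc n) (λ k → cong (p k *_) (upTo n (n ∸ k) (ℕP.m∸n≤m n k))) ⟩
        sumLt (suc n) (λ k → p k * F′ (n ∸ k))  ≡⟨ sym (at dF′ n) ⟩
        fromℕ (suc n) * F′ (suc n)              ∎)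

deriv-expS : ∀ c → deriv (expS c) ≈ scale c (expS c)
deriv-expS c = ≈i λ n → begin
  fromℕ (suc n) * (c * pow c n * invFact (suc n))  ≡⟨ reassoc (fromℕ (suc n)) c (pow c n) (invFact (suc n)) ⟩
  c * pow c n * (invFact (suc n) * fromℕ (suc n))  ≡⟨ cong (c * pow c n *_) (invFact-suc n) ⟩
  c * pow c n * invFact n                          ≡⟨ *-assoc c (pow c n) (invFact n) ⟩
  c * (pow c n * invFact n)                        ∎
  where
  reassoc : ∀ a b x y → a * (b * x * y) ≡ b * x * (y * a)
  reassoc = solve-∀ ringℚ

-- e^{at} e^{bt} = e^{(a+b)t}: both sides solve F' = (a+b) F, F(0) = 1.
expS-+ : ∀ a b → expS a ⊛ expS b ≈ expS (a + b)
expS-+ a b = ode-unique (scale (a + b) one) (expS a ⊛ expS b) (expS (a + b)) deriv-product deriv-sum refl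
  where
  deriv-product : deriv (expS a ⊛ expS b) ≈ scale (a + b) one ⊛ (expS a ⊛ expS b)
  deriv-product = ≈-trans (deriv-⊛ (expS a) (expS b))
    (≈-trans (⊕-cong (≈-trans (⊛-congˡ (expS b) (deriv-expS a)) (scale-⊛ a (expS a) (expS b)))
                     (≈-trans (⊛-congʳ (expS a) (deriv-expS b)) (⊛-scale b (expS a) (expS b))))
    (≈-trans (scale-⊕ a b (expS a ⊛ expS b)) (scale-as-⊛ (a + b) (expS a ⊛ expS b))))
  deriv-sum : deriv (expS (a + b)) ≈ scale (a + b) one ⊛ expS (a + b)
  deriv-sum = ≈-trans (deriv-expS (a + b)) (scale-as-⊛ (a + b) (expS (a + b)))

expS-cong : ∀ {a b} → a ≡ b → expS a ≈ expS b
expS-cong refl = ≈-refl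

powS-expS : ∀ c j → powS (expS c) j ≈ expS (c * fromℕ j)
powS-expS c zero = ≈i λ
  { zero → refl
  ; (suc n) → sym (trans (cong (λ z → z * pow (c * 0ℚ) n * invFact (suc n)) (*-zeroʳ c))
                  (trans (cong (_* invFact (suc n)) (*-zeroˡ (pow (c * 0ℚ) n))) (*-zeroˡ (invFact (suc n))))) }
powS-expS c (suc j) = ≈-trans (⊛-congʳ (expS c) (powS-expS c j)) (≈-trans (expS-+ c (c * fromℕ j)) (expS-cong sum))
  where
  sum : c + c * fromℕ j ≡ c * fromℕ (suc j)
  sum = sym (trans (cong (c *_) (fromℕ-+ 1 j)) (trans (*-distribˡ-+ c 1ℚ (fromℕ j)) (cong (_+ c * fromℕ j) (*-identityʳ c))))

expS-dilate : ∀ c x → expS (c * x) ≈ dilate c (expS x)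
expS-dilate c x = ≈i λ n → trans (cong (_* invFact n) (pow-* c x n)) (*-assoc (pow c n) (pow x n) (invFact n))

-- Composition e^{f} for f without constant term, via the chain rule (e^f)' = f' e^f.

expComp-trunc : ∀ f → f 0 ≡ 0ℚ → ∀ n N → n < N → expComp f n ≡ sumLt N (λ m → invFact m * powS f m n)
expComp-trunc f f0 n N n<N = begin
  expComp f n
    ≡⟨ sym (+-identityʳ (expComp f n)) ⟩
  expComp f n + 0ℚ
    ≡⟨ cong (expComp f n +_) (sym (trans (sum-cong d vanish) (sum-0 d))) ⟩
  expComp f n + sumLt d (λ i → invFact (suc n +ℕ i) * powS f (suc n +ℕ i) n)
    ≡⟨ sym (sum-split (suc n) d (λ m → invFact m * powS f m n)) ⟩
  sumLt (suc n +ℕ d) (λ m → invFact m * powS f m n)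
    ≡⟨ cong (λ M → sumLt M (λ m → invFact m * powS f m n)) (ℕP.m+[n∸m]≡n n<N) ⟩
  sumLt N (λ m → invFact m * powS f m n) ∎
  where
  d : ℕ
  d = N ∸ suc n
  vanish : ∀ i → invFact (suc n +ℕ i) * powS f (suc n +ℕ i) n ≡ 0ℚ
  vanish i = trans (cong (invFact (suc n +ℕ i) *_) (powS-vanish f f0 (suc n +ℕ i) n (s≤s (ℕP.m≤m+n n i))))
                   (*-zeroʳ (invFact (suc n +ℕ i)))

deriv-powS : ∀ f m → deriv (powS f (suc m)) ≈ scale (fromℕ (suc m)) (deriv f ⊛ powS f m)
deriv-powS f zero = ≈-trans (deriv-cong (⊛-one f)) (≈i λ n → sym (trans (*-identityˡ _) (at (⊛-one (deriv f)) n)))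
deriv-powS f (suc m) = ≈-trans (deriv-⊛ f P)
   (≈-trans (⊕-cong (≈i λ n → sym (*-identityˡ (X n))) induction)
   (≈-trans (scale-⊕ 1ℚ c X) (≈i λ n → cong (_* X n) (sym (fromℕ-+ 1 (suc m))))))
  where
  P : FPS
  P = powS f (suc m)
  X : FPS
  X = deriv f ⊛ P
  c : ℚ
  c = fromℕ (suc m)
  induction : f ⊛ deriv P ≈ scale c X
  induction = ≈-trans (⊛-congʳ f (deriv-powS f m)) (≈-trans (⊛-scale c f (deriv f ⊛ powS f m))
    (scale-cong c (≈-trans (≈-sym (⊛-assoc f (deriv f) (powS f m)))
      (≈-trans (⊛-congˡ (powS f m) (⊛-comm f (deriv f))) (⊛-assoc (deriv f) f (powS f m))))))

deriv-expComp : ∀ f → f 0 ≡ 0ℚ → deriv (expComp f) ≈ deriv f ⊛ expComp f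
deriv-expComp f f0 = ≈i λ n → begin
  fromℕ (suc n) * sumLt (suc (suc n)) (λ m → invFact m * powS f m (suc n))
    ≡⟨ sum-scaleˡ (suc (suc n)) (fromℕ (suc n)) (λ m → invFact m * powS f m (suc n)) ⟩
  sumLt (suc (suc n)) (λ m → fromℕ (suc n) * (invFact m * powS f m (suc n)))
    ≡⟨ sum-cong (suc (suc n)) (λ m → swap (fromℕ (suc n)) (invFact m) (powS f m (suc n))) ⟩
  sumLt (suc (suc n)) (λ m → invFact m * deriv (powS f m) n)
    ≡⟨ sum-front (suc n) (λ m → invFact m * deriv (powS f m) n) ⟩
  invFact 0 * deriv one n + sumLt (suc n) (λ i → invFact (suc i) * deriv (powS f (suc i)) n)
    ≡⟨ cong₂ _+_ (trans (cong (invFact 0 *_) (at deriv-one n)) (*-zeroʳ (invFact 0))) (sum-cong (suc n) (λ i → term i n)) ⟩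
  0ℚ + sumLt (suc n) (λ i → invFact i * (deriv f ⊛ powS f i) n)
    ≡⟨ +-identityˡ _ ⟩
  sumLt (suc n) (λ i → invFact i * sumLt (suc n) (λ k → deriv f k * powS f i (n ∸ k)))
    ≡⟨ sum-cong (suc n) (λ i → sum-scaleˡ (suc n) (invFact i) (λ k → deriv f k * powS f i (n ∸ k))) ⟩
  sumLt (suc n) (λ i → sumLt (suc n) (λ k → invFact i * (deriv f k * powS f i (n ∸ k))))
    ≡⟨ sum-swap (suc n) (suc n) (λ i k → invFact i * (deriv f k * powS f i (n ∸ k))) ⟩
  sumLt (suc n) (λ k → sumLt (suc n) (λ i → invFact i * (deriv f k * powS f i (n ∸ k))))
    ≡⟨ sum-cong (suc n) (λ k → trans (sum-cong (suc n) (λ i → swap (invFact i) (deriv f k) (powS f i (n ∸ k))))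
          (sym (sum-scaleˡ (suc n) (deriv f k) (λ i → invFact i * powS f i (n ∸ k))))) ⟩
  sumLt (suc n) (λ k → deriv f k * sumLt (suc n) (λ i → invFact i * powS f i (n ∸ k)))
    ≡⟨ sum-cong (suc n) (λ k → cong (deriv f k *_) (sym (expComp-trunc f f0 (n ∸ k) (suc n) (s≤s (ℕP.m∸n≤m n k))))) ⟩
  sumLt (suc n) (λ k → deriv f k * expComp f (n ∸ k)) ∎
  where
  swap : ∀ a b c → a * (b * c) ≡ b * (a * c)
  swap = solve-∀ ringℚ
  term : ∀ i n → invFact (suc i) * deriv (powS f (suc i)) n ≡ invFact i * (deriv f ⊛ powS f i) n
  term i n = begin
    invFact (suc i) * deriv (powS f (suc i)) n                ≡⟨ cong (invFact (suc i) *_) (at (deriv-powS f i) n) ⟩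
    invFact (suc i) * (fromℕ (suc i) * (deriv f ⊛ powS f i) n) ≡⟨ sym (*-assoc (invFact (suc i)) (fromℕ (suc i)) _) ⟩
    (invFact (suc i) * fromℕ (suc i)) * (deriv f ⊛ powS f i) n ≡⟨ cong (_* (deriv f ⊛ powS f i) n) (invFact-suc i) ⟩
    invFact i * (deriv f ⊛ powS f i) n                         ∎

hermiteGF : ℚ → FPS
hermiteGF y = expComp (hermiteExponent y)

gauss : FPS
gauss = hermiteGF 0ℚ

two : ℚ
two = fromℕ 2

deriv-hermiteExponent : ∀ y → deriv (hermiteExponent y) ≈ scale (two * y) one ⊕ deriv (hermiteExponent 0ℚ)
deriv-hermiteExponent y = ≈i λ
  { zero → trans (*-identityˡ (two * y))
                 (sym (trans (cong₂ _+_ (*-identityʳ (two * y)) (trans (*-identityˡ (two * 0ℚ)) (*-zeroʳ two)))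
                             (+-identityʳ _)))
  ; (suc zero) → sym (trans (cong (_+ (two * (- 1ℚ))) (*-zeroʳ (two * y))) (+-identityˡ _))
  ; (suc (suc n)) → sym (trans (cong (_+ (fromℕ (suc (suc (suc n))) * 0ℚ)) (*-zeroʳ (two * y))) (+-identityˡ _)) }

-- E_y = e^{2yt} G: both sides solve F' = (2y - 2t) F with F(0) = 1.
hermiteGF-factor : ∀ y → hermiteGF y ≈ expS (two * y) ⊛ gauss
hermiteGF-factor y =
  ode-unique (deriv (hermiteExponent y)) (hermiteGF y) F (deriv-expComp (hermiteExponent y) refl) deriv-F refl
  where
  c : ℚ
  c = two * y
  q : FPS
  q = deriv (hermiteExponent 0ℚ)
  F : FPS
  F = expS c ⊛ gauss
  deriv-F : deriv F ≈ deriv (hermiteExponent y) ⊛ F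
  deriv-F = ≈-trans (deriv-⊛ (expS c) gauss)
    (≈-trans (⊕-cong (≈-trans (⊛-congˡ gauss (deriv-expS c)) (scale-⊛ c (expS c) gauss))
                     (≈-trans (⊛-congʳ (expS c) (deriv-expComp (hermiteExponent 0ℚ) refl))
                     (≈-trans (≈-sym (⊛-assoc (expS c) q gauss))
                     (≈-trans (⊛-congˡ gauss (⊛-comm (expS c) q)) (⊛-assoc q (expS c) gauss)))))
    (≈-trans (⊕-cong (scale-as-⊛ c F) (≈-refl {q ⊛ F}))
    (≈-trans (≈-sym (⊕-⊛ F (scale c one) q))
    (⊛-congˡ F (≈-sym (deriv-hermiteExponent y))))))

signedBinom : ℕ → ℕ → ℚ
signedBinom k j = pow (- 1ℚ) (k ∸ j) * fromℕ (k C j)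

signedBinom-top : ∀ k → signedBinom k (suc k) ≡ 0ℚ
signedBinom-top k = trans (cong (λ z → pow (- 1ℚ) (k ∸ suc k) * fromℕ z) (k>n⇒nCk≡0 (ℕP.n<1+n k)))
                          (*-zeroʳ (pow (- 1ℚ) (k ∸ suc k)))

signedBinom-suc : ∀ k i → i ≤ k → signedBinom (suc k) (suc i) ≡ signedBinom k i + - signedBinom k (suc i)
signedBinom-suc k i i≤k = begin
  pow (- 1ℚ) (k ∸ i) * fromℕ (suc k C suc i)
    ≡⟨ cong (λ z → pow (- 1ℚ) (k ∸ i) * fromℕ z) (sym (nCk+nC[k+1]≡[n+1]C[k+1] k i)) ⟩
  pow (- 1ℚ) (k ∸ i) * fromℕ (k C i ℕ.+ k C suc i)
    ≡⟨ trans (cong (pow (- 1ℚ) (k ∸ i) *_) (fromℕ-+ (k C i) (k C suc i)))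
             (*-distribˡ-+ (pow (- 1ℚ) (k ∸ i)) (fromℕ (k C i)) (fromℕ (k C suc i))) ⟩
  signedBinom k i + pow (- 1ℚ) (k ∸ i) * fromℕ (k C suc i)
    ≡⟨ cong (signedBinom k i +_) (next (ℕP.m≤n⇒m<n∨m≡n i≤k)) ⟩
  signedBinom k i + - signedBinom k (suc i) ∎
  where
  next : i ℕ.< k ⊎ i ≡ k → pow (- 1ℚ) (k ∸ i) * fromℕ (k C suc i) ≡ - signedBinom k (suc i)
  next (inj₂ refl) = trans (cong (λ z → pow (- 1ℚ) (k ∸ k) * fromℕ z) (k>n⇒nCk≡0 (ℕP.n<1+n k)))
                           (trans (*-zeroʳ (pow (- 1ℚ) (k ∸ k))) (sym (cong -_ (signedBinom-top k))))
  next (inj₁ i<k) = trans (cong (λ m → pow (- 1ℚ) m * fromℕ (k C suc i)) (ℕP.+-∸-assoc 1 i<k))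
                          (trans (*-assoc (- 1ℚ) (pow (- 1ℚ) (k ∸ suc i)) (fromℕ (k C suc i)))
                                 (neg-one-* (signedBinom k (suc i))))

pascal-sum : ∀ k (U : ℕ → ℚ) →
  sumLt (suc k) (λ j → signedBinom k j * U (suc j)) + - sumLt (suc k) (λ j → signedBinom k j * U j)
  ≡ sumLt (suc (suc k)) (λ j → signedBinom (suc k) j * U j)
pascal-sum k U = sym (begin
  sumLt (suc (suc k)) (λ j → signedBinom (suc k) j * U j)
    ≡⟨ sum-front (suc k) (λ j → signedBinom (suc k) j * U j) ⟩
  signedBinom (suc k) 0 * U 0 + sumLt (suc k) (λ i → signedBinom (suc k) (suc i) * U (suc i))
    ≡⟨ cong₂ _+_ first (sum-cong< (suc k) (λ i i< → pascal i (ℕP.≤-pred i<))) ⟩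
  - x + sumLt (suc k) (λ i → signedBinom k i * U (suc i) + - (signedBinom k (suc i) * U (suc i)))
    ≡⟨ cong (- x +_) (trans (sum-+ (suc k) _ _) (cong (A +_) (sym (sum-neg (suc k) (λ i → signedBinom k (suc i) * U (suc i)))))) ⟩
  - x + (A + - (T + signedBinom k (suc k) * U (suc k)))
    ≡⟨ cong (λ z → - x + (A + - (T + z))) (trans (cong (_* U (suc k)) (signedBinom-top k)) (*-zeroˡ (U (suc k)))) ⟩
  - x + (A + - (T + 0ℚ))
    ≡⟨ cong (λ z → - x + (A + - z)) (+-identityʳ T) ⟩
  - x + (A + - T)
    ≡⟨ regroup A T x ⟩
  A + - (x + T)
    ≡⟨ cong (λ z → A + - z) (sym (sum-front k (λ j → signedBinom k j * U j))) ⟩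
  A + - sumLt (suc k) (λ j → signedBinom k j * U j) ∎)
  where
  A : ℚ
  A = sumLt (suc k) (λ j → signedBinom k j * U (suc j))
  T : ℚ
  T = sumLt k (λ i → signedBinom k (suc i) * U (suc i))
  x : ℚ
  x = signedBinom k 0 * U 0
  regroup : ∀ a t y → - y + (a + - t) ≡ a + - (y + t)
  regroup = solve-∀ ringℚ
  first : signedBinom (suc k) 0 * U 0 ≡ - x
  first = trans (cong (_* U 0) (*-assoc (- 1ℚ) (pow (- 1ℚ) k) (fromℕ 1)))
                (trans (*-assoc (- 1ℚ) (signedBinom k 0) (U 0)) (neg-one-* x))
  pascal : ∀ i → i ≤ k → signedBinom (suc k) (suc i) * U (suc i) ≡ signedBinom k i * U (suc i) + - (signedBinom k (suc i) * U (suc i))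
  pascal i i≤k = trans (cong (_* U (suc i)) (signedBinom-suc k i i≤k))
    (trans (*-distribʳ-+ (U (suc i)) (signedBinom k i) (- signedBinom k (suc i)))
           (cong (signedBinom k i * U (suc i) +_) (sym (neg-distribˡ-* (signedBinom k (suc i)) (U (suc i))))))

binomial : ∀ f k → powS (f ⊕ scale (- 1ℚ) one) k ≈ (λ N → sumLt (suc k) (λ j → signedBinom k j * powS f j N))
binomial f zero = ≈i λ N → sym (trans (+-identityˡ _) (*-identityˡ (one N)))
binomial f (suc k) = ≈-trans (⊛-congʳ (f ⊕ scale (- 1ℚ) one) (binomial f k))
  (≈-trans (⊕-⊛ S f (scale (- 1ℚ) one))
  (≈-trans (⊕-cong (≈-trans (⊛-comm f S) (≈-trans (sum-⊛ (suc k) f (λ j → scale (signedBinom k j) (powS f j)))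
                      (≈i λ N → sum-cong (suc k) (λ j → trans (at (scale-⊛ (signedBinom k j) (powS f j) f) N)
                                 (cong (signedBinom k j *_) (at (⊛-comm (powS f j) f) N))))))
                   (≈-trans (scale-⊛ (- 1ℚ) one S) (≈i λ N → trans (neg-one-* _) (cong -_ (at (one-⊛ S) N)))))
  (≈i λ N → pascal-sum k (λ j → powS f j N))))
  where
  S : FPS
  S N = sumLt (suc k) (λ j → signedBinom k j * powS f j N)

expm1-shift : expm1 ≈ shift expm1Div
expm1-shift = ≈i λ { zero → refl ; (suc n) → refl }

dilate-expm1 : ∀ c → dilate c expm1 ≈ expS c ⊕ scale (- 1ℚ) one
dilate-expm1 c = ≈i λ
  { zero → refl
  ; (suc n) → sym (trans (cong (pow c (suc n) * invFact (suc n) +_) (*-zeroʳ (- 1ℚ))) (+-identityʳ _)) }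

D : ℕ → FPS
D a = powS expm1Div a

-- (e^t - 1)^m = t^m D_m; hence D_m[l] = m! S₂(l+m, m)/(l+m)!.
expm1Pow-D : ∀ m l → powS expm1 m (l +ℕ m) ≡ D m l
expm1Pow-D m l = trans (at (powS-cong m expm1-shift) (l +ℕ m)) (trans (at (powS-shift m expm1Div) (l +ℕ m))
  (trans (cong (shiftBy m (D m)) (ℕP.+-comm l m)) (shiftBy-at m (D m) l)))

expm1Pow-⊛ : ∀ c a F → powS (dilate c expm1) a ⊛ F ≈ scale (pow c a) (shiftBy a (dilate c (D a) ⊛ F))
expm1Pow-⊛ c a F =
  ≈-trans (⊛-congˡ F (powS-dilate a c expm1))
  (≈-trans (⊛-congˡ F (dilate-cong c (≈-trans (powS-cong a expm1-shift) (powS-shift a expm1Div))))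
  (≈-trans (⊛-congˡ F (dilate-shiftBy a c (D a)))
  (≈-trans (scale-⊛ (pow c a) (shiftBy a (dilate c (D a))) F)
  (scale-cong (pow c a) (shiftBy-⊛ a (dilate c (D a)) F)))))

-- (e^{2t} - 1)^k G = Σ_{j ≤ k} (-1)^{k-j} C(k,j) E_j, since e^{2jt} G = E_j.
expm1Pow-gauss : ∀ k → powS (dilate two expm1) k ⊛ gauss ≈ (λ N → sumLt (suc k) (λ j → signedBinom k j * hermiteGF (fromℕ j) N))
expm1Pow-gauss k =
  ≈-trans (⊛-congˡ gauss (≈-trans (powS-cong k (dilate-expm1 two)) (binomial (expS two) k)))
  (≈-trans (sum-⊛ (suc k) gauss (λ j → scale (signedBinom k j) (powS (expS two) j)))
  (≈i λ N → sum-cong (suc k) (λ j → trans (at (scale-⊛ (signedBinom k j) (powS (expS two) j) gauss) N)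
      (cong (signedBinom k j *_) (trans (at (⊛-congˡ gauss (powS-expS two j)) N) (sym (at (hermiteGF-factor (fromℕ j)) N)))))))

-- Bernoulli generating function b_{r,x} = (t/(e^t - 1))^r e^{xt}, so B r k x = k! b_{r,x}[k].

bernoulliGF : ℕ → ℚ → FPS
bernoulliGF r x = powS bernGen r ⊛ expS x

expS-bernoulli : ∀ r x → expS x ≈ D r ⊛ bernoulliGF r x
expS-bernoulli r x = ≈-sym (≈-trans (≈-sym (⊛-assoc (D r) (powS bernGen r) (expS x)))
  (≈-trans (⊛-congˡ (expS x) (expm1Div-bernGen r)) (one-⊛ (expS x))))

Q : ℕ → FPS
Q r = dilate two (D r) ⊛ gauss

hermite-bernoulli : ∀ r x → hermiteGF x ≈ dilate two (bernoulliGF r x) ⊛ Q r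
hermite-bernoulli r x = ≈-trans (hermiteGF-factor x)
  (≈-trans (⊛-congˡ gauss (≈-trans (expS-dilate two x) (dilate-cong two (expS-bernoulli r x))))
  (≈-trans (⊛-congˡ gauss (≈-trans (dilate-⊛ two (D r) (bernoulliGF r x)) (⊛-comm (dilate two (D r)) (dilate two (bernoulliGF r x)))))
  (⊛-assoc (dilate two (bernoulliGF r x)) (dilate two (D r)) gauss)))

Q-coeff-high : ∀ r M → pow two r * Q r M ≡ sumLt (suc r) (λ j → signedBinom r j * hermiteGF (fromℕ j) (r +ℕ M))
Q-coeff-high r M = begin
  pow two r * Q r M                          ≡⟨ cong (pow two r *_) (sym (shiftBy-at r (Q r) M)) ⟩
  pow two r * shiftBy r (Q r) (r +ℕ M)       ≡⟨ sym (at (expm1Pow-⊛ two r gauss) (r +ℕ M)) ⟩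
  (powS (dilate two expm1) r ⊛ gauss) (r +ℕ M) ≡⟨ at (expm1Pow-gauss r) (r +ℕ M) ⟩
  sumLt (suc r) (λ j → signedBinom r j * hermiteGF (fromℕ j) (r +ℕ M)) ∎

-- For k ≤ r, writing D_r = D_{r-k} D_k:
-- 2^k Q_r[n-k] = Σ_{l ≤ n} 2^l D_{r-k}[l] Σ_{j ≤ k} (-1)^{k-j} C(k,j) E_j[n-l].
Q-coeff-low : ∀ r k n → k ≤ r → k ≤ n →
  pow two k * Q r (n ∸ k) ≡
  sumLt (suc n) (λ l → (pow two l * D (r ∸ k) l) * sumLt (suc k) (λ j → signedBinom k j * hermiteGF (fromℕ j) (n ∸ l)))
Q-coeff-low r k n k≤r k≤n = begin
  pow two k * Q r (n ∸ k)                      ≡⟨ cong (pow two k *_) (sym (shiftBy-at k (Q r) (n ∸ k))) ⟩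
  pow two k * shiftBy k (Q r) (k +ℕ (n ∸ k))   ≡⟨ cong (λ m → pow two k * shiftBy k (Q r) m) (ℕP.m+[n∸m]≡n k≤n) ⟩
  pow two k * shiftBy k (Q r) n                ≡⟨ sym (at factor n) ⟩
  (Y ⊛ (powS (dilate two expm1) k ⊛ gauss)) n  ≡⟨ at (⊛-congʳ Y (expm1Pow-gauss k)) n ⟩
  sumLt (suc n) (λ l → (pow two l * D (r ∸ k) l) * sumLt (suc k) (λ j → signedBinom k j * hermiteGF (fromℕ j) (n ∸ l))) ∎
  where
  Y : FPS
  Y = dilate two (D (r ∸ k))
  factor : Y ⊛ (powS (dilate two expm1) k ⊛ gauss) ≈ scale (pow two k) (shiftBy k (Q r))
  factor =
    ≈-trans (⊛-congʳ Y (expm1Pow-⊛ two k gauss))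
    (≈-trans (⊛-scale (pow two k) Y (shiftBy k (dilate two (D k) ⊛ gauss)))
    (scale-cong (pow two k) (≈-trans (⊛-shiftBy k Y (dilate two (D k) ⊛ gauss)) (shiftBy-cong k
    (≈-trans (≈-sym (⊛-assoc Y (dilate two (D k)) gauss)) (⊛-congˡ gauss
    (≈-trans (≈-sym (dilate-⊛ two (D (r ∸ k)) (D k)))
    (dilate-cong two (≈-trans (≈-sym (powS-+ expm1Div (r ∸ k) k)) (powS-idx expm1Div (ℕP.m∸n+n≡m k≤r)))))))))))

term-high : ∀ r n x k → r ≤ k →
  (pow two k * bernoulliGF r x k) * Q r (n ∸ k) ≡
  sumFromTo 0 r (λ j → pow (- 1ℚ) (r ∸ j) * fromℕ (r C j) * fromℕ (2 ^ℕ (k ∸ r))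
              * H ((n ∸ k) +ℕ r) (fromℕ j) * invFact k * invFact ((n ∸ k) +ℕ r)) * B r k x
term-high r n x k r≤k = sym (begin
  sumLt (suc r) (λ j → signedBinom r j * fromℕ (2 ^ℕ (k ∸ r)) * H M (fromℕ j) * invFact k * invFact M) * B r k x
    ≡⟨ cong (_* B r k x) (sum-cong (suc r) summand) ⟩
  sumLt (suc r) (λ j → (t * invFact k) * (signedBinom r j * hermiteGF (fromℕ j) M)) * B r k x
    ≡⟨ cong (_* B r k x) (sym (sum-scaleˡ (suc r) (t * invFact k) (λ j → signedBinom r j * hermiteGF (fromℕ j) M))) ⟩
  (t * invFact k) * sumLt (suc r) (λ j → signedBinom r j * hermiteGF (fromℕ j) M) * B r k x
    ≡⟨ cong (λ z → (t * invFact k) * z * B r k x) (trans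
          (cong (λ m → sumLt (suc r) (λ j → signedBinom r j * hermiteGF (fromℕ j) m)) (ℕP.+-comm (n ∸ k) r))
          (sym (Q-coeff-high r (n ∸ k)))) ⟩
  (t * invFact k) * (pow two r * Q r (n ∸ k)) * (fromℕ (k !) * bernoulliGF r x k)
    ≡⟨ collect t (invFact k) (pow two r) (Q r (n ∸ k)) (fromℕ (k !)) (bernoulliGF r x k) (pow two k)
         (trans (cong (pow two) (sym (ℕP.m+[n∸m]≡n r≤k))) (pow-+ two r (k ∸ r))) (fact*invFact k) ⟩
  (pow two k * bernoulliGF r x k) * Q r (n ∸ k) ∎)
  where
  M : ℕ
  M = (n ∸ k) +ℕ r
  t : ℚ
  t = pow two (k ∸ r)
  -- H_M(j) = M! E_j[M], and the M! cancels against 1/M!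
  summand : ∀ j → signedBinom r j * fromℕ (2 ^ℕ (k ∸ r)) * H M (fromℕ j) * invFact k * invFact M
                  ≡ (t * invFact k) * (signedBinom r j * hermiteGF (fromℕ j) M)
  summand j = trans (cong (λ z → signedBinom r j * z * H M (fromℕ j) * invFact k * invFact M) (fromℕ-^ 2 (k ∸ r)))
    (cancel (signedBinom r j) t (fromℕ (M !)) (hermiteGF (fromℕ j) M) (invFact k) (invFact M) (fact*invFact M))
    where
    cancel : ∀ s t f e ik im → f * im ≡ 1ℚ → s * t * (f * e) * ik * im ≡ (t * ik) * (s * e)
    cancel s t f e ik im h = trans (reassoc s t f e ik im) (trans (cong (_* ((t * ik) * (s * e))) h) (*-identityˡ _))
      where
      reassoc : ∀ s t f e ik im → s * t * (f * e) * ik * im ≡ (f * im) * ((t * ik) * (s * e))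
      reassoc = solve-∀ ringℚ
  -- 2^{k-r} 2^r = 2^k, and k! cancels against 1/k!
  collect : ∀ t ik p q fk b p′ → p′ ≡ p * t → fk * ik ≡ 1ℚ → (t * ik) * (p * q) * (fk * b) ≡ (p′ * b) * q
  collect t ik p q fk b p′ e h = trans (reassoc t ik p q fk b)
    (trans (cong (_* ((p * t * b) * q)) h) (trans (*-identityˡ _) (cong (λ z → (z * b) * q) (sym e))))
    where
    reassoc : ∀ t ik p q fk b → (t * ik) * (p * q) * (fk * b) ≡ (fk * ik) * ((p * t * b) * q)
    reassoc = solve-∀ ringℚ

term-low : ∀ r n x k → k ≤ r → k ≤ n →
  (pow two k * bernoulliGF r x k) * Q r (n ∸ k) ≡
  sumFromTo 0 k (λ j → sumFromTo 0 n (λ l →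
            fromℕ ((r ∸ k) !) * S2 (l +ℕ (r ∸ k)) (r ∸ k) * pow (- 1ℚ) (k ∸ j)
              * fromℕ (k C j) * fromℕ (2 ^ℕ l) * H (n ∸ l) (fromℕ j)
              * invFact (l +ℕ (r ∸ k)) * invFact k * invFact (n ∸ l))) * B r k x
term-low r n x k k≤r k≤n = sym (begin
  sumLt (suc k) (λ j → sumLt (suc n) (summand j)) * B r k x
    ≡⟨ cong (_* B r k x) (sum-cong (suc k) (λ j → sum-cong (suc n) (normal j))) ⟩
  sumLt (suc k) (λ j → sumLt (suc n) (λ l → invFact k * (Y l * X j l))) * B r k x
    ≡⟨ cong (_* B r k x) (sum-swap-factor (suc k) (suc n) (invFact k) Y X) ⟩
  invFact k * sumLt (suc n) (λ l → Y l * sumLt (suc k) (λ j → X j l)) * B r k x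
    ≡⟨ cong (λ z → invFact k * z * B r k x) (sym (Q-coeff-low r k n k≤r k≤n)) ⟩
  invFact k * (pow two k * Q r (n ∸ k)) * (fromℕ (k !) * bernoulliGF r x k)
    ≡⟨ collect (invFact k) (pow two k) (Q r (n ∸ k)) (fromℕ (k !)) (bernoulliGF r x k) (fact*invFact k) ⟩
  (pow two k * bernoulliGF r x k) * Q r (n ∸ k) ∎)
  where
  m : ℕ
  m = r ∸ k
  Y : ℕ → ℚ
  Y l = pow two l * D m l
  X : ℕ → ℕ → ℚ
  X j l = signedBinom k j * hermiteGF (fromℕ j) (n ∸ l)
  summand : ℕ → ℕ → ℚ
  summand j l = fromℕ (m !) * S2 (l +ℕ m) m * pow (- 1ℚ) (k ∸ j) * fromℕ (k C j) * fromℕ (2 ^ℕ l)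
                * H (n ∸ l) (fromℕ j) * invFact (l +ℕ m) * invFact k * invFact (n ∸ l)
  -- S₂(l+m, m) = (l+m)!/m! · (e^t - 1)^m[l+m] and H_{n-l}(j) = (n-l)! E_j[n-l]; all three factorials cancel
  cancel : ∀ a ia b ib c ic P s bn p e ik → a * ia ≡ 1ℚ → b * ib ≡ 1ℚ → c * ic ≡ 1ℚ →
    a * (b * ia * P) * s * bn * p * (c * e) * ib * ik * ic ≡ ik * ((p * P) * (s * bn * e))
  cancel a ia b ib c ic P s bn p e ik h₁ h₂ h₃ = trans (reassoc a ia b ib c ic P s bn p e ik)
    (trans (cong (λ z → z * (b * ib) * (c * ic) * rest) h₁)
    (trans (cong (λ z → 1ℚ * z * (c * ic) * rest) h₂)
    (trans (cong (λ z → 1ℚ * 1ℚ * z * rest) h₃) (*-identityˡ rest))))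
    where
    rest : ℚ
    rest = ik * ((p * P) * (s * bn * e))
    reassoc : ∀ a ia b ib c ic P s bn p e ik →
      a * (b * ia * P) * s * bn * p * (c * e) * ib * ik * ic ≡ (a * ia) * (b * ib) * (c * ic) * (ik * ((p * P) * (s * bn * e)))
    reassoc = solve-∀ ringℚ
  normal : ∀ j l → summand j l ≡ invFact k * (Y l * X j l)
  normal j l = trans
    (cancel (fromℕ (m !)) (invFact m) (fromℕ ((l +ℕ m) !)) (invFact (l +ℕ m)) (fromℕ ((n ∸ l) !)) (invFact (n ∸ l))
            (powS expm1 m (l +ℕ m)) (pow (- 1ℚ) (k ∸ j)) (fromℕ (k C j)) (fromℕ (2 ^ℕ l)) (hermiteGF (fromℕ j) (n ∸ l)) (invFact k)
            (fact*invFact m) (fact*invFact (l +ℕ m)) (fact*invFact (n ∸ l)))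
    (cong (invFact k *_) (cong₂ (λ p P → (p * P) * X j l) (fromℕ-^ 2 l) (expm1Pow-D m l)))
  -- k! cancels against 1/k!
  collect : ∀ ik p q fk b → fk * ik ≡ 1ℚ → ik * (p * q) * (fk * b) ≡ (p * b) * q
  collect ik p q fk b h = trans (reassoc ik p q fk b) (trans (cong (_* ((p * b) * q)) h) (*-identityˡ _))
    where
    reassoc : ∀ ik p q fk b → ik * (p * q) * (fk * b) ≡ (fk * ik) * ((p * b) * q)
    reassoc = solve-∀ ringℚ

theorem7 : (r n : ℕ) → r ≤ n → (x : ℚ) →
    H n x ≡
      fromℕ (n !) * sumLt r (λ k →
          sumFromTo 0 k (λ j → sumFromTo 0 n (λ l →
            fromℕ ((r ∸ k) !) * S2 (l +ℕ (r ∸ k)) (r ∸ k) * pow (- 1ℚ) (k ∸ j)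
              * fromℕ (k C j) * fromℕ (2 ^ℕ l) * H (n ∸ l) (fromℕ j)
              * invFact (l +ℕ (r ∸ k)) * invFact k * invFact (n ∸ l)))
          * B r k x)
      + fromℕ (n !) * sumFromTo r n (λ k →
          sumFromTo 0 r (λ j →
            pow (- 1ℚ) (r ∸ j) * fromℕ (r C j) * fromℕ (2 ^ℕ (k ∸ r))
              * H ((n ∸ k) +ℕ r) (fromℕ j) * invFact k * invFact ((n ∸ k) +ℕ r))
          * B r k x)
theorem7 r n r≤n x = begin
  fromℕ (n !) * hermiteGF x n
    ≡⟨ cong (fromℕ (n !) *_) (at (hermite-bernoulli r x) n) ⟩
  fromℕ (n !) * sumLt (suc n) T
    ≡⟨ cong (fromℕ (n !) *_) (sum-split-at r (suc n) T (ℕP.m≤n⇒m≤1+n r≤n)) ⟩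
  fromℕ (n !) * (sumLt r T + sumLt (suc n ∸ r) (λ i → T (r +ℕ i)))
    ≡⟨ cong (fromℕ (n !) *_) (cong₂ _+_
         (sum-cong< r (λ k k<r → term-low r n x k (ℕP.<⇒≤ k<r) (ℕP.≤-trans (ℕP.<⇒≤ k<r) r≤n)))
         (sum-cong (suc n ∸ r) (λ i → term-high r n x (r +ℕ i) (ℕP.m≤m+n r i)))) ⟩
  _ ≡⟨ *-distribˡ-+ (fromℕ (n !)) _ _ ⟩
  _ ∎
  where
  T : ℕ → ℚ
  T k = (pow two k * bernoulliGF r x k) * Q r (n ∸ k)
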